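{- For $n\ge0$ and $0\le j,k\le n$: $\sum_{j=0}^{n}b(n,k,j)=A(n+1,k)$ and $\sum_{k=0}^{n}b(n,k,j)=n!$.
   Context: $\mathcal{B}_n$ is the set of signed permutations of order $n$: bijections $\sigma$ of $\{ -n,\ldots,n\}$ with $\sigma(-i)=-\sigma(i)$, identified with $(0,\sigma_1,\ldots,\sigma_n)$; $\mathrm{des}(\sigma)$ is the number of $i\in\{1,\ldots,n\}$ with $\sigma_{i-1}>\sigma_i$ ($\sigma_0=0$). For $0\le j,k\le n$, $b(n,k,j)$ is the number of $\sigma\in\mathcal{B}_n$ with $\mathrm{des}(\sigma)=k$ such that for every $1\le i\le n$, $\sigma_i<0$ iff $|\sigma_i|\in\{1,\ldots,j\}$. $A(m,k)$ is the number of permutations $(\tau_1,\ldots,\tau_m)$ of $\{1,\ldots,m\}$ with exactly $k$ indices $i$ such that $\tau_i>\tau_{i+1}$. -}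

module Defs where

open import Data.Bool using (Bool; true; false; not; _∧_; if_then_else_)
open import Data.Nat using (ℕ; zero; suc; _+_; _≡ᵇ_; _≤ᵇ_; _<ᵇ_)
open import Data.Integer as ℤ using (ℤ; +_; -[1+_]; ∣_∣)
open import Data.Integer.Properties using (_<?_)
open import Data.List using (List; []; _∷_; _++_; map; concatMap; upTo; length; filterᵇ)
open import Data.Bool.ListAction using (all; any)
open import Relation.Nullary.Decidable using (⌊_⌋)

allLists : {A : Set} → List A → ℕ → List (List A)
allLists L zero    = [] ∷ []
allLists L (suc n) = concatMap (λ x → map (x ∷_) (allLists L n)) L

intRange : ℕ → List ℤ
intRange n = map +_ (upTo (suc n)) ++ map -[1+_] (upTo n)

distinct : List ℕ → Bool
distinct []       = true
distinct (x ∷ xs) = not (any (x ≡ᵇ_) xs) ∧ distinct xs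

-- A list (σ₁,…,σₙ) of integers of length n is (the window of) a signed permutation
-- of order n iff every σᵢ is nonzero with |σᵢ| ≤ n and the |σᵢ| are pairwise
-- distinct, i.e. i ↦ |σᵢ| is a bijection of {1,…,n}; then σ(-i) = -σ(i) extends it
-- uniquely to a bijection of {-n,…,n}.
isSignedPerm : ℕ → List ℤ → Bool
isSignedPerm n σ = all (λ x → not (∣ x ∣ ≡ᵇ 0) ∧ (∣ x ∣ ≤ᵇ n)) σ ∧ distinct (map ∣_∣ σ)

signedPerms : ℕ → List (List ℤ)
signedPerms n = filterᵇ (isSignedPerm n) (allLists (intRange n) n)

descentsℤ : List ℤ → ℕ
descentsℤ []           = 0
descentsℤ (x ∷ [])     = 0
descentsℤ (x ∷ y ∷ xs) = (if ⌊ y <? x ⌋ then 1 else 0) + descentsℤ (y ∷ xs)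

des : List ℤ → ℕ
des σ = descentsℤ (+ 0 ∷ σ)

-- σᵢ < 0 iff |σᵢ| ∈ {1,…,j}, for every i
signCond : ℕ → List ℤ → Bool
signCond j σ = all (λ x → eqB ⌊ x <? + 0 ⌋ ((1 ≤ᵇ ∣ x ∣) ∧ (∣ x ∣ ≤ᵇ j))) σ
  where
  eqB : Bool → Bool → Bool
  eqB true  b = b
  eqB false b = not b

b : ℕ → ℕ → ℕ → ℕ
b n k j = length (filterᵇ (λ σ → (des σ ≡ᵇ k) ∧ signCond j σ) (signedPerms n))

perms : ℕ → List (List ℕ)
perms m = filterᵇ distinct (allLists (map suc (upTo m)) m)

descentsℕ : List ℕ → ℕ
descentsℕ []           = 0
descentsℕ (x ∷ [])     = 0
descentsℕ (x ∷ y ∷ xs) = (if y <ᵇ x then 1 else 0) + descentsℕ (y ∷ xs)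

A : ℕ → ℕ → ℕ
A m k = length (filterᵇ (λ τ → descentsℕ τ ≡ᵇ k) (perms m))

sumTo : ℕ → (ℕ → ℕ) → ℕ
sumTo zero    f = f 0
sumTo (suc n) f = sumTo n f + f (suc n)

-- Reading σ₀ = 0, σ₁, …, σₙ with values in
-- {-j,…,-1} ∪ {0} ∪ {j+1,…,n} and relabelling this set order-preservingly
-- onto {1,…,n+1} turns σ into a permutation of {1,…,n+1} that starts with
-- j+1; since the relabelling preserves order, descents are preserved, and
-- every permutation starting with j+1 arises exactly once. Hence b(n,k,j)
-- counts permutations of {1,…,n+1} with first letter j+1 and k descents.
-- Summing over the first letter gives A(n+1,k); summing over k counts the
-- arrangements of the remaining n letters, n!.
module Submission where

open import Defs
open import Algebra.Properties.CommutativeSemigroup using (interchange)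
open import Data.Bool using (Bool; true; false; not; _∧_; _∨_; T; if_then_else_)
open import Data.Bool.ListAction using (all; any)
open import Data.Bool.Properties using (T?; T-∧; T-≡; T-not-≡; ∧-identityʳ)
open import Data.Empty using (⊥-elim)
open import Data.Integer as ℤ using (ℤ; +_; +[1+_]; -[1+_]; ∣_∣)
open import Data.Integer.Properties using (_<?_)
import Data.Integer.Properties as ℤ
open import Data.List
  using (List; []; _∷_; _++_; [_]; _∷ʳ_; map; concatMap; filterᵇ; length; upTo; applyUpTo)
open import Data.List.Properties
  using ( length-++; length-map; length-applyUpTo; filter-++; filter-all; filter-none
        ; filter-accept; filter-reject; map-cong; map-cong-local; map-∘; map-++
        ; map-applyUpTo; upTo-∷ʳ; ++-identityʳ)
open import Data.List.Membership.Propositional using (_∈_)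
open import Data.List.Membership.Propositional.Properties using (∈-map⁺; ∈-upTo⁺)
open import Data.List.Relation.Binary.Permutation.Propositional
  using (_↭_; ↭-refl; prep; module PermutationReasoning)
import Data.List.Relation.Binary.Permutation.Propositional.Properties as ↭
open import Data.List.Relation.Unary.All as All using (All; []; _∷_)
open import Data.List.Relation.Unary.All.Properties using (all-filter; all-upTo; filter⁺; ++⁺; map⁺)
open import Data.List.Relation.Unary.AllPairs using ([]; _∷_)
open import Data.List.Relation.Unary.Any as Any using ()
open import Data.List.Relation.Unary.Any.Properties using (any⁺)
open import Data.List.Relation.Unary.Unique.Propositional using (Unique)
import Data.List.Relation.Unary.Unique.Propositional.Properties as Unique
open import Data.Nat
  using (ℕ; zero; suc; _+_; _*_; _∸_; _≤_; _<_; _≡ᵇ_; _<ᵇ_; _≤ᵇ_; _!; z≤n; s≤s)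
open import Data.Nat.ListAction using (sum)
open import Data.Nat.ListAction.Properties using (sum-++; sum-↭)
open import Data.Nat.Properties
  using ( ≡ᵇ⇒≡; ≡⇒≡ᵇ; <ᵇ⇒<; <⇒<ᵇ; <-cmp; <-irrefl; <-asym; <⇒≢; <⇒≱; <⇒≤; ≮⇒≥; ≤-trans
        ; ≤-pred; n≤1+n; m≤n⇒m≤1+n; m≤n⇒m<n∨m≡n; m∸n≤m; ∸-monoʳ-<; suc-injective
        ; +-identityʳ; +-commutativeSemigroup)
open import Data.Product using (_×_; _,_; proj₁; proj₂)
open import Data.Sum using (inj₁; inj₂)
open import Data.Unit using (⊤; tt)
open import Function using (_∘_; id)
open import Function.Bundles using (Equivalence)
open import Relation.Binary.Definitions using (tri<; tri≈; tri>)
open import Relation.Binary.PropositionalEquality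
  using (_≡_; _≢_; refl; sym; trans; cong; cong₂; subst; module ≡-Reasoning)
open import Relation.Nullary using (¬_; contradiction; proof)
open import Relation.Nullary.Decidable using (⌊_⌋; isYes≗does)
open import Relation.Nullary.Reflects using (fromEquivalence; det; T-reflects)

T-∧ˡ : ∀ a {b} → T (a ∧ b) → T a
T-∧ˡ true _ = _

T-∧ʳ : ∀ a {b} → T (a ∧ b) → T b
T-∧ʳ true t = t

T-ext : {a b : Bool} → (T a → T b) → (T b → T a) → a ≡ b
T-ext a⇒b b⇒a = det (fromEquivalence a⇒b b⇒a) (T-reflects _)

≢⇒T-not-≡ᵇ : {m n : ℕ} → m ≢ n → T (not (m ≡ᵇ n))
≢⇒T-not-≡ᵇ {m} {n} m≢n with m ≡ᵇ n in eq
... | true  = contradiction (≡ᵇ⇒≡ m n (subst T (sym eq) _)) m≢n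
... | false = _

T-not-≡ᵇ⇒≢ : {m n : ℕ} → T (not (m ≡ᵇ n)) → m ≢ n
T-not-≡ᵇ⇒≢ {m} m≢ᵇm refl with m ≡ᵇ m | ≡⇒≡ᵇ m m refl
... | true | _ = m≢ᵇm

<ᵇ-suc≡not-<ᵇ : ∀ m n → (m <ᵇ suc n) ≡ not (n <ᵇ m)
<ᵇ-suc≡not-<ᵇ zero    n       = refl
<ᵇ-suc≡not-<ᵇ (suc m) zero    = refl
<ᵇ-suc≡not-<ᵇ (suc m) (suc n) = <ᵇ-suc≡not-<ᵇ m n

≡ᵇ-cong-injective : {A : Set} {P : A → Set} (f g : A → ℕ) →
  (∀ {x y} → P x → P y → f x ≡ f y → x ≡ y) → (∀ {x y} → P x → P y → g x ≡ g y → x ≡ y) →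
  ∀ {x y} → P x → P y → (f x ≡ᵇ f y) ≡ (g x ≡ᵇ g y)
≡ᵇ-cong-injective f g f-inj g-inj {x} {y} px py =
  T-ext (λ t → ≡⇒≡ᵇ (g x) (g y) (cong g (f-inj px py (≡ᵇ⇒≡ (f x) (f y) t))))
        (λ t → ≡⇒≡ᵇ (f x) (f y) (cong f (g-inj px py (≡ᵇ⇒≡ (g x) (g y) t))))

module _ {A : Set} {p : A → Bool} where

  not-any⇒All : (xs : List A) → T (not (any p xs)) → All (T ∘ not ∘ p) xs
  not-any⇒All []       _ = []
  not-any⇒All (x ∷ xs) h with p x in px
  ... | false = subst (T ∘ not) (sym px) _ ∷ not-any⇒All xs h

  All⇒not-any : {xs : List A} → All (T ∘ not ∘ p) xs → T (not (any p xs))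
  All⇒not-any []                  = _
  All⇒not-any {x ∷ _} (_ ∷ ¬pxs) with p x
  ... | false = All⇒not-any ¬pxs

∈⇒any-≡ᵇ : {x : ℕ} {xs : List ℕ} → x ∈ xs → T (any (x ≡ᵇ_) xs)
∈⇒any-≡ᵇ {x} x∈xs = any⁺ (x ≡ᵇ_) (Any.map (≡⇒≡ᵇ x _) x∈xs)

module _ {A : Set} where

  filterᵇ-cong : {p q : A → Bool} {xs : List A} → All (λ x → p x ≡ q x) xs → filterᵇ p xs ≡ filterᵇ q xs
  filterᵇ-cong [] = refl
  filterᵇ-cong {p} {q} {x ∷ xs} (_ ∷ eqs) with p x | q x
  ... | true  | true  = cong (x ∷_) (filterᵇ-cong eqs)
  ... | false | false = filterᵇ-cong eqs
  filterᵇ-cong (() ∷ _) | true  | false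
  filterᵇ-cong (() ∷ _) | false | true

  sum-map-filterᵇ : (s : A → Bool) (f : A → ℕ) (xs : List A) → (∀ {x} → ¬ T (s x) → f x ≡ 0) →
    sum (map f xs) ≡ sum (map f (filterᵇ s xs))
  sum-map-filterᵇ s f []       _   = refl
  sum-map-filterᵇ s f (x ∷ xs) off with s x in sx
  ... | true  = cong (_+_ (f x)) (sum-map-filterᵇ s f xs off)
  ... | false = cong₂ _+_ (off (subst T sx)) (sum-map-filterᵇ s f xs off)

  sum-map-const : (c : ℕ) (xs : List A) → sum (map (λ _ → c) xs) ≡ length xs * c
  sum-map-const c []       = refl
  sum-map-const c (x ∷ xs) = cong (_+_ c) (sum-map-const c xs)

filterᵇ-map : {A B : Set} (p : B → Bool) (f : A → B) (xs : List A) →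
  filterᵇ p (map f xs) ≡ map f (filterᵇ (p ∘ f) xs)
filterᵇ-map p f [] = refl
filterᵇ-map p f (x ∷ xs) with p (f x)
... | true  = cong (f x ∷_) (filterᵇ-map p f xs)
... | false = filterᵇ-map p f xs

count : {A : Set} → (A → Bool) → List A → ℕ
count p xs = length (filterᵇ p xs)

module _ {A : Set} where

  count-cong : {p q : A → Bool} {xs : List A} → All (λ x → p x ≡ q x) xs → count p xs ≡ count q xs
  count-cong = cong length ∘ filterᵇ-cong

  count-none : (p : A → Bool) (xs : List A) → (∀ x → ¬ T (p x)) → count p xs ≡ 0
  count-none p xs ¬p = cong length (filter-none (T? ∘ p) (All.universal ¬p xs))

  count-∷ : (p : A → Bool) (x : A) (xs : List A) → count p (x ∷ xs) ≡ (if p x then 1 else 0) + count p xs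
  count-∷ p x xs with p x
  ... | true  = refl
  ... | false = refl

  count-++ : (p : A → Bool) (xs ys : List A) → count p (xs ++ ys) ≡ count p xs + count p ys
  count-++ p xs ys = trans (cong length (filter-++ (T? ∘ p) xs ys)) (length-++ (filterᵇ p xs))

  count-filterᵇ : (p q : A → Bool) (xs : List A) → count p (filterᵇ q xs) ≡ count (λ x → q x ∧ p x) xs
  count-filterᵇ p q [] = refl
  count-filterᵇ p q (x ∷ xs) with q x
  ... | false = count-filterᵇ p q xs
  ... | true with p x
  ...   | true  = cong suc (count-filterᵇ p q xs)
  ...   | false = count-filterᵇ p q xs

module _ {A B : Set} where

  count-map : (p : B → Bool) (f : A → B) (xs : List A) → count p (map f xs) ≡ count (p ∘ f) xs
  count-map p f xs = trans (cong length (filterᵇ-map p f xs)) (length-map f (filterᵇ (p ∘ f) xs))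

  count-concatMap : (p : B → Bool) (f : A → List B) (xs : List A) →
    count p (concatMap f xs) ≡ sum (map (count p ∘ f) xs)
  count-concatMap p f [] = refl
  count-concatMap p f (x ∷ xs) =
    trans (count-++ p (f x) (concatMap f xs)) (cong (_+_ (count p (f x))) (count-concatMap p f xs))

-- Counting words

module _ {A : Set} where

  count-allLists-suc : (p : List A → Bool) (L : List A) (n : ℕ) →
    count p (allLists L (suc n)) ≡ sum (map (λ x → count (p ∘ (x ∷_)) (allLists L n)) L)
  count-allLists-suc p L n = trans (count-concatMap p _ L)
    (cong sum (map-cong (λ x → count-map p (x ∷_) (allLists L n)) L))

  All-allLists : {P : A → Set} {Q : List A → Set} {L : List A} (n : ℕ) →
    (∀ {σ} → length σ ≡ n → All P σ → Q σ) → All P L → All Q (allLists L n)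
  All-allLists zero h _ = h refl [] ∷ []
  All-allLists {P} {Q} {L} (suc n) h pL = go pL
    where
    go : ∀ {L′} → All P L′ → All Q (concatMap (λ x → map (x ∷_) (allLists L n)) L′)
    go []         = []
    go (px ∷ pL′) = ++⁺ (map⁺ (All-allLists n (λ l pσ → h (cong suc l) (px ∷ pσ)) pL)) (go pL′)

  count-allLists-cong : {s : A → Bool} {p q : List A → Bool} {L : List A} (n : ℕ) →
    (∀ {σ} → All (T ∘ s) σ → p σ ≡ q σ) → All (T ∘ s) L →
    count p (allLists L n) ≡ count q (allLists L n)
  count-allLists-cong n p≡q sL = count-cong (All-allLists n (λ _ → p≡q) sL)

  count-allLists-restrict : (s : A → Bool) (p : List A → Bool) (L : List A) (n : ℕ) →
    (∀ {σ} → T (p σ) → All (T ∘ s) σ) →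
    count p (allLists L n) ≡ count p (allLists (filterᵇ s L) n)
  count-allLists-restrict s p L zero    _   = refl
  count-allLists-restrict s p L (suc n) p⇒s = begin
    count p (allLists L (suc n))
      ≡⟨ count-allLists-suc p L n ⟩
    sum (map (branch L) L)
      ≡⟨ sum-map-filterᵇ s (branch L) L dead-branch ⟩
    sum (map (branch L) (filterᵇ s L))
      ≡⟨ cong sum (map-cong-local (All.map ih (all-filter (T? ∘ s) L))) ⟩
    sum (map (branch (filterᵇ s L)) (filterᵇ s L))
      ≡⟨ count-allLists-suc p (filterᵇ s L) n ⟨
    count p (allLists (filterᵇ s L) (suc n)) ∎
    where
    open ≡-Reasoning
    branch : List A → A → ℕ
    branch L′ x = count (p ∘ (x ∷_)) (allLists L′ n)
    dead-branch : ∀ {x} → ¬ T (s x) → branch L x ≡ 0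
    dead-branch ¬sx = count-none _ (allLists L n) (λ σ pxσ → ¬sx (All.head (p⇒s pxσ)))
    ih : ∀ {x} → T (s x) → branch L x ≡ branch (filterᵇ s L) x
    ih {x} _ = count-allLists-restrict s (p ∘ (x ∷_)) L n (All.tail ∘ p⇒s)

  count-allLists-↭ : (p : List A → Bool) {L L′ : List A} → L ↭ L′ → (n : ℕ) →
    count p (allLists L n) ≡ count p (allLists L′ n)
  count-allLists-↭ p π zero = refl
  count-allLists-↭ p {L} {L′} π (suc n) = begin
    count p (allLists L (suc n))
      ≡⟨ count-allLists-suc p L n ⟩
    sum (map (λ x → count (p ∘ (x ∷_)) (allLists L n)) L)
      ≡⟨ cong sum (map-cong (λ x → count-allLists-↭ (p ∘ (x ∷_)) π n) L) ⟩
    sum (map (λ x → count (p ∘ (x ∷_)) (allLists L′ n)) L)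
      ≡⟨ sum-↭ (↭.map⁺ _ π) ⟩
    sum (map (λ x → count (p ∘ (x ∷_)) (allLists L′ n)) L′)
      ≡⟨ count-allLists-suc p L′ n ⟨
    count p (allLists L′ (suc n)) ∎
    where open ≡-Reasoning

count-allLists-map : {A B : Set} (p : List B → Bool) (f : A → B) (L : List A) (n : ℕ) →
  count p (allLists (map f L) n) ≡ count (p ∘ map f) (allLists L n)
count-allLists-map p f L zero with p []
... | true  = refl
... | false = refl
count-allLists-map p f L (suc n) = begin
  count p (allLists (map f L) (suc n))
    ≡⟨ count-allLists-suc p (map f L) n ⟩
  sum (map (λ y → count (p ∘ (y ∷_)) (allLists (map f L) n)) (map f L))
    ≡⟨ cong sum (map-∘ L) ⟨
  sum (map (λ x → count (p ∘ (f x ∷_)) (allLists (map f L) n)) L)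
    ≡⟨ cong sum (map-cong (λ x → count-allLists-map (p ∘ (f x ∷_)) f L n) L) ⟩
  sum (map (λ x → count (p ∘ map f ∘ (x ∷_)) (allLists L n)) L)
    ≡⟨ count-allLists-suc (p ∘ map f) L n ⟨
  count (p ∘ map f) (allLists L (suc n)) ∎
  where open ≡-Reasoning

T-distinct-∷ : (x : ℕ) (xs : List ℕ) → T (distinct (x ∷ xs)) → T (not (any (x ≡ᵇ_) xs)) × T (distinct xs)
T-distinct-∷ x xs = Equivalence.to T-∧

Unique⇒distinct : {xs : List ℕ} → Unique xs → T (distinct xs)
Unique⇒distinct []           = _
Unique⇒distinct (x∉xs ∷ uxs) =
  Equivalence.from T-∧ (All⇒not-any (All.map ≢⇒T-not-≡ᵇ x∉xs) , Unique⇒distinct uxs)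

distinct-map-cong : {A : Set} {P : A → Set} (f g : A → ℕ) →
  (∀ {x y} → P x → P y → (f x ≡ᵇ f y) ≡ (g x ≡ᵇ g y)) →
  {xs : List A} → All P xs → distinct (map f xs) ≡ distinct (map g xs)
distinct-map-cong {A} {P} f g f≈g = go
  where
  any-cong : ∀ {x} → P x → {ys : List A} → All P ys → any (f x ≡ᵇ_) (map f ys) ≡ any (g x ≡ᵇ_) (map g ys)
  any-cong px []         = refl
  any-cong px (py ∷ pys) = cong₂ _∨_ (f≈g px py) (any-cong px pys)
  go : {xs : List A} → All P xs → distinct (map f xs) ≡ distinct (map g xs)
  go []         = refl
  go (px ∷ pxs) = cong₂ (λ a d → not a ∧ d) (any-cong px pxs) (go pxs)

remove : ℕ → List ℕ → List ℕ
remove x = filterᵇ (not ∘ (x ≡ᵇ_))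

distinct-filterᵇ : (s : ℕ → Bool) (xs : List ℕ) → T (distinct xs) → T (distinct (filterᵇ s xs))
distinct-filterᵇ s []       _ = _
distinct-filterᵇ s (x ∷ xs) d with T-distinct-∷ x xs d | s x
... | _    , dxs | false = distinct-filterᵇ s xs dxs
... | x∉xs , dxs | true  = Equivalence.from T-∧
  (All⇒not-any (filter⁺ (T? ∘ s) (not-any⇒All xs x∉xs)) , distinct-filterᵇ s xs dxs)

length-remove : (x : ℕ) (xs : List ℕ) → T (distinct xs) → T (any (x ≡ᵇ_) xs) →
  suc (length (remove x xs)) ≡ length xs
length-remove x (y ∷ xs) d x∈ with x ≡ᵇ y in x≡ᵇy
... | true rewrite ≡ᵇ⇒≡ x y (Equivalence.from T-≡ x≡ᵇy) =
  cong (suc ∘ length) (filter-all (T? ∘ (not ∘ (y ≡ᵇ_))) (not-any⇒All xs (proj₁ (T-distinct-∷ y xs d))))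
... | false = cong suc (length-remove x xs (proj₂ (T-distinct-∷ y xs d)) x∈)

count-distinct-∷ : (x : ℕ) (L : List ℕ) (r : ℕ) →
  count (distinct ∘ (x ∷_)) (allLists L r) ≡ count distinct (allLists (remove x L) r)
count-distinct-∷ x L r = trans
  (count-allLists-restrict (not ∘ (x ≡ᵇ_)) (distinct ∘ (x ∷_)) L r
    (λ {σ} d → not-any⇒All σ (proj₁ (T-distinct-∷ x σ d))))
  (count-allLists-cong r (λ x∉σ → cong (_∧ _) (Equivalence.to T-≡ (All⇒not-any x∉σ)))
    (all-filter (T? ∘ (not ∘ (x ≡ᵇ_))) L))

count-arrangements : (r : ℕ) (L : List ℕ) → length L ≡ r → T (distinct L) →
  count distinct (allLists L r) ≡ r !
count-arrangements zero    [] _ _ = refl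
count-arrangements (suc r) L  l d = begin
  count distinct (allLists L (suc r))
    ≡⟨ count-allLists-suc distinct L r ⟩
  sum (map (λ x → count (distinct ∘ (x ∷_)) (allLists L r)) L)
    ≡⟨ cong sum (map-cong-local (All.tabulate arrangements-after)) ⟩
  sum (map (λ _ → r !) L)
    ≡⟨ sum-map-const (r !) L ⟩
  length L * r !
    ≡⟨ cong (_* r !) l ⟩
  suc r ! ∎
  where
  open ≡-Reasoning
  arrangements-after : ∀ {x} → x ∈ L → count (distinct ∘ (x ∷_)) (allLists L r) ≡ r !
  arrangements-after {x} x∈L = trans (count-distinct-∷ x L r)
    (count-arrangements r (remove x L) (suc-injective (trans (length-remove x L d (∈⇒any-≡ᵇ x∈L)) l))
      (distinct-filterᵇ (not ∘ (x ≡ᵇ_)) L d))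

-- Finite sums

sumTo-upTo : (n : ℕ) (f : ℕ → ℕ) → sumTo n f ≡ sum (map f (upTo (suc n)))
sumTo-upTo zero    f = sym (+-identityʳ (f 0))
sumTo-upTo (suc n) f = begin
  sumTo n f + f (suc n)                             ≡⟨ cong₂ _+_ (sumTo-upTo n f) (sym (+-identityʳ (f (suc n)))) ⟩
  sum (map f (upTo (suc n))) + (f (suc n) + 0)      ≡⟨ sum-++ (map f (upTo (suc n))) [ f (suc n) ] ⟨
  sum (map f (upTo (suc n)) ++ map f [ suc n ])     ≡⟨ cong sum (map-++ f (upTo (suc n)) [ suc n ]) ⟨
  sum (map f (upTo (suc n) ∷ʳ suc n))               ≡⟨ cong (sum ∘ map f) (upTo-∷ʳ (suc n)) ⟩
  sum (map f (upTo (suc (suc n))))                  ∎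
  where open ≡-Reasoning

sumTo-cong : (n : ℕ) {f g : ℕ → ℕ} → (∀ {i} → i ≤ n → f i ≡ g i) → sumTo n f ≡ sumTo n g
sumTo-cong n {f} {g} f≗g = begin
  sumTo n f                    ≡⟨ sumTo-upTo n f ⟩
  sum (map f (upTo (suc n)))   ≡⟨ cong sum (map-cong-local (All.map (f≗g ∘ ≤-pred) (all-upTo (suc n)))) ⟩
  sum (map g (upTo (suc n)))   ≡⟨ sumTo-upTo n g ⟨
  sumTo n g                    ∎
  where open ≡-Reasoning

sumTo-+ : (n : ℕ) (f g : ℕ → ℕ) → sumTo n (λ i → f i + g i) ≡ sumTo n f + sumTo n g
sumTo-+ zero    f g = refl
sumTo-+ (suc n) f g = trans (cong (_+ (f (suc n) + g (suc n))) (sumTo-+ n f g))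
  (interchange +-commutativeSemigroup (sumTo n f) (sumTo n g) (f (suc n)) (g (suc n)))

sumTo-zero : (n : ℕ) → sumTo n (λ _ → 0) ≡ 0
sumTo-zero zero    = refl
sumTo-zero (suc n) = trans (+-identityʳ _) (sumTo-zero n)

indicator-≢ : {c i : ℕ} → c ≢ i → (if c ≡ᵇ i then 1 else 0) ≡ 0
indicator-≢ c≢i = cong (λ b → if b then 1 else 0) (Equivalence.to T-not-≡ (≢⇒T-not-≡ᵇ c≢i))

sumTo-indicator : {c n : ℕ} → c ≤ n → sumTo n (λ i → if c ≡ᵇ i then 1 else 0) ≡ 1
sumTo-indicator {c} {zero}  z≤n   = refl
sumTo-indicator {c} {suc n} c≤1+n with m≤n⇒m<n∨m≡n c≤1+n
... | inj₁ c<1+n = cong₂ _+_ (sumTo-indicator (≤-pred c<1+n)) (indicator-≢ (λ c≡1+n → <-irrefl c≡1+n c<1+n))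
... | inj₂ refl  = cong₂ _+_
  (trans (sumTo-cong n (λ i≤n → indicator-≢ (λ c≡i → <-irrefl (sym c≡i) (s≤s i≤n)))) (sumTo-zero n))
  (cong (λ b → if b then 1 else 0) (Equivalence.to T-≡ (≡⇒≡ᵇ c c refl)))

sumTo-count-fibres : {A : Set} (q : A → Bool) (f : A → ℕ) (n : ℕ) {xs : List A} →
  All (λ a → f a ≤ n) xs → sumTo n (λ k → count (λ a → q a ∧ (f a ≡ᵇ k)) xs) ≡ count q xs
sumTo-count-fibres q f n []                        = sumTo-zero n
sumTo-count-fibres q f n {x ∷ xs} (fx≤n ∷ bounds) = begin
  sumTo n (λ k → count (fibre k) (x ∷ xs))
    ≡⟨ sumTo-cong n (λ {k} _ → count-∷ (fibre k) x xs) ⟩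
  sumTo n (λ k → (if fibre k x then 1 else 0) + count (fibre k) xs)
    ≡⟨ sumTo-+ n (λ k → if fibre k x then 1 else 0) (λ k → count (fibre k) xs) ⟩
  sumTo n (λ k → if fibre k x then 1 else 0) + sumTo n (λ k → count (fibre k) xs)
    ≡⟨ cong₂ _+_ x-in-one-fibre (sumTo-count-fibres q f n bounds) ⟩
  (if q x then 1 else 0) + count q xs
    ≡⟨ count-∷ q x xs ⟨
  count q (x ∷ xs) ∎
  where
  open ≡-Reasoning
  fibre : ℕ → _ → Bool
  fibre k a = q a ∧ (f a ≡ᵇ k)
  x-in-one-fibre : sumTo n (λ k → if fibre k x then 1 else 0) ≡ (if q x then 1 else 0)
  x-in-one-fibre with q x
  ... | true  = sumTo-indicator fx≤n
  ... | false = sumTo-zero n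

filterᵇ-<ᵇ-upTo : ∀ {j} N → j ≤ N → filterᵇ (_<ᵇ j) (upTo N) ≡ upTo j
filterᵇ-<ᵇ-upTo {j} zero    z≤n   = refl
filterᵇ-<ᵇ-upTo {j} (suc N) j≤1+N with m≤n⇒m<n∨m≡n j≤1+N
... | inj₂ refl  = filter-all (T? ∘ (_<ᵇ j)) (All.map <⇒<ᵇ (all-upTo j))
... | inj₁ j<1+N = begin
  filterᵇ (_<ᵇ j) (upTo (suc N))                      ≡⟨ cong (filterᵇ (_<ᵇ j)) (upTo-∷ʳ N) ⟨
  filterᵇ (_<ᵇ j) (upTo N ++ [ N ])                   ≡⟨ filter-++ (T? ∘ (_<ᵇ j)) (upTo N) [ N ] ⟩
  filterᵇ (_<ᵇ j) (upTo N) ++ filterᵇ (_<ᵇ j) [ N ]   ≡⟨ cong₂ _++_ (filterᵇ-<ᵇ-upTo N j≤N) N≮j ⟩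
  upTo j ++ []                                         ≡⟨ ++-identityʳ (upTo j) ⟩
  upTo j                                               ∎
  where
  open ≡-Reasoning
  N≮j : filterᵇ (_<ᵇ j) [ N ] ≡ []
  j≤N : j ≤ N
  j≤N = ≤-pred j<1+N
  N≮j = filter-reject (T? ∘ (_<ᵇ j)) (λ N<j → <⇒≱ (<ᵇ⇒< N j N<j) j≤N)

module _ (j : ℕ) where
  open PermutationReasoning

  filterᵇ-≢-↭ : (xs : List ℕ) →
    filterᵇ (not ∘ (j ≡ᵇ_)) xs ↭ filterᵇ (_<ᵇ j) xs ++ filterᵇ (j <ᵇ_) xs
  filterᵇ-≢-↭ []       = ↭-refl
  filterᵇ-≢-↭ (x ∷ xs) with <-cmp x j
  ... | tri< x<j _ _ = begin
    filterᵇ (not ∘ (j ≡ᵇ_)) (x ∷ xs)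
      ≡⟨ filter-accept (T? ∘ (not ∘ (j ≡ᵇ_))) {x} {xs} (≢⇒T-not-≡ᵇ (λ j≡x → <-irrefl (sym j≡x) x<j)) ⟩
    x ∷ filterᵇ (not ∘ (j ≡ᵇ_)) xs
      ↭⟨ prep x (filterᵇ-≢-↭ xs) ⟩
    x ∷ (filterᵇ (_<ᵇ j) xs ++ filterᵇ (j <ᵇ_) xs)
      ≡⟨ cong₂ _++_ (filter-accept (T? ∘ (_<ᵇ j)) {x} {xs} (<⇒<ᵇ x<j))
                    (filter-reject (T? ∘ (j <ᵇ_)) {x} {xs} (<-asym x<j ∘ <ᵇ⇒< j x)) ⟨
    filterᵇ (_<ᵇ j) (x ∷ xs) ++ filterᵇ (j <ᵇ_) (x ∷ xs) ∎
  ... | tri≈ _ refl _ = begin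
    filterᵇ (not ∘ (j ≡ᵇ_)) (j ∷ xs)
      ≡⟨ filter-reject (T? ∘ (not ∘ (j ≡ᵇ_))) {j} {xs} (λ j≢j → T-not-≡ᵇ⇒≢ {j} j≢j refl) ⟩
    filterᵇ (not ∘ (j ≡ᵇ_)) xs
      ↭⟨ filterᵇ-≢-↭ xs ⟩
    filterᵇ (_<ᵇ j) xs ++ filterᵇ (j <ᵇ_) xs
      ≡⟨ cong₂ _++_ (filter-reject (T? ∘ (_<ᵇ j)) {j} {xs} (<-irrefl refl ∘ <ᵇ⇒< j j))
                    (filter-reject (T? ∘ (j <ᵇ_)) {j} {xs} (<-irrefl refl ∘ <ᵇ⇒< j j)) ⟨
    filterᵇ (_<ᵇ j) (j ∷ xs) ++ filterᵇ (j <ᵇ_) (j ∷ xs) ∎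
  ... | tri> _ _ j<x = begin
    filterᵇ (not ∘ (j ≡ᵇ_)) (x ∷ xs)
      ≡⟨ filter-accept (T? ∘ (not ∘ (j ≡ᵇ_))) {x} {xs} (≢⇒T-not-≡ᵇ (λ j≡x → <-irrefl j≡x j<x)) ⟩
    x ∷ filterᵇ (not ∘ (j ≡ᵇ_)) xs
      ↭⟨ prep x (filterᵇ-≢-↭ xs) ⟩
    x ∷ (filterᵇ (_<ᵇ j) xs ++ filterᵇ (j <ᵇ_) xs)
      ↭⟨ ↭.shift x (filterᵇ (_<ᵇ j) xs) (filterᵇ (j <ᵇ_) xs) ⟨
    filterᵇ (_<ᵇ j) xs ++ x ∷ filterᵇ (j <ᵇ_) xs
      ≡⟨ cong₂ _++_ (filter-reject (T? ∘ (_<ᵇ j)) {x} {xs} (<-asym j<x ∘ <ᵇ⇒< x j))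
                    (filter-accept (T? ∘ (j <ᵇ_)) {x} {xs} (<⇒<ᵇ j<x)) ⟨
    filterᵇ (_<ᵇ j) (x ∷ xs) ++ filterᵇ (j <ᵇ_) (x ∷ xs) ∎

map-∸-upTo-↭ : (j : ℕ) → map (j ∸_) (upTo j) ↭ map suc (upTo j)
map-∸-upTo-↭ zero    = ↭-refl
map-∸-upTo-↭ (suc j) = begin
  map (suc j ∸_) (upTo (suc j))   ≡⟨ cong (suc j ∷_) (map-applyUpTo suc (suc j ∸_) j) ⟩
  suc j ∷ applyUpTo (j ∸_) j      ≡⟨ cong (suc j ∷_) (map-applyUpTo id (j ∸_) j) ⟨
  suc j ∷ map (j ∸_) (upTo j)     ↭⟨ prep (suc j) (map-∸-upTo-↭ j) ⟩
  suc j ∷ map suc (upTo j)        ↭⟨ ↭.∷↭∷ʳ (suc j) (map suc (upTo j)) ⟩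
  map suc (upTo j) ∷ʳ suc j       ≡⟨ map-++ suc (upTo j) [ j ] ⟨
  map suc (upTo j ∷ʳ j)           ≡⟨ cong (map suc) (upTo-∷ʳ j) ⟩
  map suc (upTo (suc j))          ∎
  where open PermutationReasoning

-- Order embeddings of integers into ℕ

module StrictlyMonotone {P : ℤ → Set} (f : ℤ → ℕ)
  (mono : ∀ {x y} → P x → P y → x ℤ.< y → f x < f y) where

  reflects-< : ∀ {x y} → P x → P y → f x < f y → x ℤ.< y
  reflects-< {x} {y} px py fx<fy with ℤ.<-cmp x y
  ... | tri< x<y _ _  = x<y
  ... | tri≈ _ refl _ = contradiction refl (<⇒≢ fx<fy)
  ... | tri> _ _ y<x  = contradiction fx<fy (<-asym (mono py px y<x))

  injective : ∀ {x y} → P x → P y → f x ≡ f y → x ≡ y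
  injective {x} {y} px py fx≡fy with ℤ.<-cmp x y
  ... | tri< x<y _ _ = contradiction fx≡fy (<⇒≢ (mono px py x<y))
  ... | tri≈ _ x≡y _ = x≡y
  ... | tri> _ _ y<x = contradiction (sym fx≡fy) (<⇒≢ (mono py px y<x))

  ⌊<?⌋≡<ᵇ : ∀ {x y} → P x → P y → ⌊ x <? y ⌋ ≡ (f x <ᵇ f y)
  ⌊<?⌋≡<ᵇ {x} {y} px py = trans (isYes≗does (x <? y))
    (det (proof (x <? y)) (fromEquivalence (reflects-< px py ∘ <ᵇ⇒< (f x) (f y)) (<⇒<ᵇ ∘ mono px py)))

descents-map : {P : ℤ → Set} (f : ℤ → ℕ) → (∀ {x y} → P x → P y → ⌊ x <? y ⌋ ≡ (f x <ᵇ f y)) →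
  ∀ {x σ} → P x → All P σ → descentsℤ (x ∷ σ) ≡ descentsℕ (f x ∷ map f σ)
descents-map f f-< px []        = refl
descents-map f f-< px (py ∷ pσ) =
  cong₂ (λ b d → (if b then 1 else 0) + d) (f-< py px) (descents-map f f-< py pσ)

-- The relabelling of class j

data Letter (j : ℕ) : ℤ → Set where
  positive : ∀ {m} → j ≤ m → Letter j +[1+ m ]
  negative : ∀ {m} → m < j → Letter j -[1+ m ]

data Point (j : ℕ) : ℤ → Set where
  origin : Point j (+ 0)
  letter : ∀ {x} → Letter j x → Point j x

-- {-j,…,-1} ↦ {1,…,j},  0 ↦ j+1,  {j+1,…,n} ↦ {j+2,…,n+1}
relabel : ℕ → ℤ → ℕ
relabel j (+ zero) = suc j
relabel j +[1+ m ] = suc (suc m)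
relabel j -[1+ m ] = j ∸ m

relabel-mono : ∀ {j x y} → Point j x → Point j y → x ℤ.< y → relabel j x < relabel j y
relabel-mono origin (letter (positive j≤m)) _ = s≤s (s≤s j≤m)
relabel-mono (letter (positive _)) (letter (positive _)) (ℤ.+<+ m<n) = s≤s m<n
relabel-mono {j} (letter (negative {m} _)) origin _ = s≤s (m∸n≤m j m)
relabel-mono {j} (letter (negative {m} _)) (letter (positive j≤n)) _ =
  s≤s (≤-trans (m∸n≤m j m) (≤-trans j≤n (n≤1+n _)))
relabel-mono (letter (negative m<j)) (letter (negative _)) (ℤ.-<- n<m) = ∸-monoʳ-< n<m (<⇒≤ m<j)
relabel-mono origin                origin                (ℤ.+<+ ())
relabel-mono origin                (letter (negative _)) ()
relabel-mono (letter (positive _)) origin                (ℤ.+<+ ())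
relabel-mono (letter (positive _)) (letter (negative _)) ()

∣∣-injective : ∀ {j x y} → Letter j x → Letter j y → ∣ x ∣ ≡ ∣ y ∣ → x ≡ y
∣∣-injective (positive _)   (positive _)   refl = refl
∣∣-injective (negative _)   (negative _)   refl = refl
∣∣-injective (positive j≤m) (negative m<j) refl = contradiction j≤m (<⇒≱ m<j)
∣∣-injective (negative m<j) (positive j≤m) refl = contradiction j≤m (<⇒≱ m<j)

origin≢letter : ∀ {j x} → Letter j x → + 0 ≢ x
origin≢letter (positive _) ()
origin≢letter (negative _) ()

inRange : ℕ → ℤ → Bool
inRange n x = not (∣ x ∣ ≡ᵇ 0) ∧ (∣ x ∣ ≤ᵇ n)

isLetter : ℕ → ℕ → ℤ → Bool
isLetter n j x = inRange n x ∧ signCond j (x ∷ [])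

letters : ℕ → ℕ → List ℤ
letters n j = filterᵇ (isLetter n j) (intRange n)

signCond-∷ : ∀ j x σ → signCond j (x ∷ σ) ≡ signCond j (x ∷ []) ∧ signCond j σ
signCond-∷ j x σ = cong (_∧ signCond j σ) (sym (∧-identityʳ _))

All-isLetter⇒ : ∀ {n j σ} → All (T ∘ isLetter n j) σ → T (all (inRange n) σ) × T (signCond j σ)
All-isLetter⇒ [] = _ , _
All-isLetter⇒ {n} {j} {x ∷ σ} (h ∷ hs) =
  Equivalence.from T-∧ (T-∧ˡ (inRange n x) h , proj₁ (All-isLetter⇒ hs)) ,
  subst T (sym (signCond-∷ j x σ)) (Equivalence.from T-∧ (T-∧ʳ (inRange n x) h , proj₂ (All-isLetter⇒ hs)))

All-isLetter⇐ : ∀ {n j σ} → T (all (inRange n) σ) → T (signCond j σ) → All (T ∘ isLetter n j) σ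
All-isLetter⇐ {σ = []} _ _ = []
All-isLetter⇐ {n} {j} {x ∷ σ} r s =
  Equivalence.from T-∧ (T-∧ˡ (inRange n x) r , T-∧ˡ (signCond j (x ∷ [])) s′) ∷
  All-isLetter⇐ (T-∧ʳ (inRange n x) r) (T-∧ʳ (signCond j (x ∷ [])) s′)
  where
  s′ : T (signCond j (x ∷ []) ∧ signCond j σ)
  s′ = subst T (signCond-∷ j x σ) s

letter-of : ∀ {n j} x → T (isLetter n j x) → Letter j x
letter-of {n} {j} +[1+ m ] h with m <ᵇ j in m<ᵇj
... | false = positive (≮⇒≥ (λ m<j → subst T m<ᵇj (<⇒<ᵇ m<j)))
... | true  = ⊥-elim (T-∧ʳ (m <ᵇ n) h)
letter-of {n} {j} -[1+ m ] h = negative (<ᵇ⇒< m j (T-∧ˡ (m <ᵇ j) (T-∧ʳ (m <ᵇ n) h)))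

module _ {n j : ℕ} where
  open ≡-Reasoning

  isLetter-+ : ∀ {m} → m < suc n → isLetter n j (+ m) ≡ (j <ᵇ m)
  isLetter-+ {zero}  _         = refl
  isLetter-+ {suc m} (s≤s m<n) = trans (cong (_∧ signCond j (+[1+ m ] ∷ [])) (Equivalence.to T-≡ (<⇒<ᵇ m<n)))
    (trans (∧-identityʳ _) (sym (<ᵇ-suc≡not-<ᵇ j m)))

  isLetter-- : ∀ {m} → m < n → isLetter n j -[1+ m ] ≡ (m <ᵇ j)
  isLetter-- {m} m<n = trans (cong (_∧ signCond j (-[1+ m ] ∷ [])) (Equivalence.to T-≡ (<⇒<ᵇ m<n)))
    (∧-identityʳ _)

  relabel-positives :
    map (relabel j) (filterᵇ (isLetter n j) (map +_ (upTo (suc n)))) ≡ map suc (filterᵇ (j <ᵇ_) (upTo (suc n)))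
  relabel-positives = begin
    map (relabel j) (filterᵇ (isLetter n j) (map +_ (upTo (suc n))))
      ≡⟨ cong (map (relabel j)) (filterᵇ-map (isLetter n j) +_ (upTo (suc n))) ⟩
    map (relabel j) (map +_ (filterᵇ (isLetter n j ∘ +_) (upTo (suc n))))
      ≡⟨ map-∘ _ ⟨
    map (relabel j ∘ +_) (filterᵇ (isLetter n j ∘ +_) (upTo (suc n)))
      ≡⟨ cong (map (relabel j ∘ +_)) (filterᵇ-cong (All.map isLetter-+ (all-upTo (suc n)))) ⟩
    map (relabel j ∘ +_) (filterᵇ (j <ᵇ_) (upTo (suc n)))
      ≡⟨ map-cong-local (All.map relabel-+ (all-filter (T? ∘ (j <ᵇ_)) (upTo (suc n)))) ⟩
    map suc (filterᵇ (j <ᵇ_) (upTo (suc n))) ∎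
    where
    relabel-+ : ∀ {m} → T (j <ᵇ m) → relabel j (+ m) ≡ suc m
    relabel-+ {suc m} _ = refl

  relabel-negatives : j ≤ n → map (relabel j) (filterᵇ (isLetter n j) (map -[1+_] (upTo n))) ≡ map (j ∸_) (upTo j)
  relabel-negatives j≤n = begin
    map (relabel j) (filterᵇ (isLetter n j) (map -[1+_] (upTo n)))
      ≡⟨ cong (map (relabel j)) (filterᵇ-map (isLetter n j) -[1+_] (upTo n)) ⟩
    map (relabel j) (map -[1+_] (filterᵇ (isLetter n j ∘ -[1+_]) (upTo n)))
      ≡⟨ map-∘ _ ⟨
    map (j ∸_) (filterᵇ (isLetter n j ∘ -[1+_]) (upTo n))
      ≡⟨ cong (map (j ∸_)) (filterᵇ-cong (All.map isLetter-- (all-upTo n))) ⟩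
    map (j ∸_) (filterᵇ (_<ᵇ j) (upTo n))
      ≡⟨ cong (map (j ∸_)) (filterᵇ-<ᵇ-upTo n j≤n) ⟩
    map (j ∸_) (upTo j) ∎

oneTo : ℕ → List ℕ
oneTo m = map suc (upTo m)

relabel-letters↭ : ∀ {n j} → j ≤ n → map (relabel j) (letters n j) ↭ remove (suc j) (oneTo (suc n))
relabel-letters↭ {n} {j} j≤n = begin
  map (relabel j) (filterᵇ (isLetter n j) (map +_ (upTo (suc n)) ++ map -[1+_] (upTo n)))
    ≡⟨ cong (map (relabel j)) (filter-++ (T? ∘ isLetter n j) (map +_ (upTo (suc n))) _) ⟩
  map (relabel j) (filterᵇ (isLetter n j) (map +_ (upTo (suc n))) ++ filterᵇ (isLetter n j) (map -[1+_] (upTo n)))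
    ≡⟨ map-++ (relabel j) (filterᵇ (isLetter n j) (map +_ (upTo (suc n)))) _ ⟩
  map (relabel j) (filterᵇ (isLetter n j) (map +_ (upTo (suc n)))) ++
  map (relabel j) (filterᵇ (isLetter n j) (map -[1+_] (upTo n)))
    ≡⟨ cong₂ _++_ (relabel-positives {n}) (relabel-negatives j≤n) ⟩
  map suc above ++ map (j ∸_) (upTo j)
    ↭⟨ ↭.++⁺ˡ (map suc above) (map-∸-upTo-↭ j) ⟩
  map suc above ++ map suc (upTo j)
    ↭⟨ ↭.++-comm (map suc above) (map suc (upTo j)) ⟩
  map suc (upTo j) ++ map suc above
    ≡⟨ cong (λ l → map suc l ++ map suc above) (filterᵇ-<ᵇ-upTo (suc n) (m≤n⇒m≤1+n j≤n)) ⟨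
  map suc (filterᵇ (_<ᵇ j) (upTo (suc n))) ++ map suc above
    ≡⟨ map-++ suc (filterᵇ (_<ᵇ j) (upTo (suc n))) above ⟨
  map suc (filterᵇ (_<ᵇ j) (upTo (suc n)) ++ above)
    ↭⟨ ↭.map⁺ suc (filterᵇ-≢-↭ j (upTo (suc n))) ⟨
  map suc (filterᵇ (not ∘ (j ≡ᵇ_)) (upTo (suc n)))
    ≡⟨ filterᵇ-map (not ∘ (suc j ≡ᵇ_)) suc (upTo (suc n)) ⟨
  remove (suc j) (oneTo (suc n)) ∎
  where
  open PermutationReasoning
  above : List ℕ
  above = filterᵇ (j <ᵇ_) (upTo (suc n))

-- Counting b(n,k,j) and A(m,k)

isPermWithDescents : ℕ → List ℕ → Bool
isPermWithDescents k τ = distinct τ ∧ (descentsℕ τ ≡ᵇ k)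

isSignedPermWith : ℕ → ℕ → ℕ → List ℤ → Bool
isSignedPermWith n k j σ = isSignedPerm n σ ∧ ((des σ ≡ᵇ k) ∧ signCond j σ)

isSignedPermWith≡isPermWithDescents : ∀ {n k j σ} → All (T ∘ isLetter n j) σ →
  isSignedPermWith n k j σ ≡ isPermWithDescents k (suc j ∷ map (relabel j) σ)
isSignedPermWith≡isPermWithDescents {n} {k} {j} {σ} isLetters = begin
  (all (inRange n) σ ∧ distinct (map ∣_∣ σ)) ∧ ((des σ ≡ᵇ k) ∧ signCond j σ)
    ≡⟨ cong₂ (λ r s → (r ∧ distinct (map ∣_∣ σ)) ∧ ((des σ ≡ᵇ k) ∧ s))
             (Equivalence.to T-≡ (proj₁ (All-isLetter⇒ isLetters)))
             (Equivalence.to T-≡ (proj₂ (All-isLetter⇒ isLetters))) ⟩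
  distinct (map ∣_∣ σ) ∧ ((des σ ≡ᵇ k) ∧ true)
    ≡⟨ cong₂ _∧_ distinct-relabel (∧-identityʳ _) ⟩
  distinct (map (relabel j) σ) ∧ (des σ ≡ᵇ k)
    ≡⟨ cong₂ (λ f d → (f ∧ distinct (map (relabel j) σ)) ∧ (d ≡ᵇ k)) (sym origin-fresh) des-relabel ⟩
  isPermWithDescents k (suc j ∷ map (relabel j) σ) ∎
  where
  open ≡-Reasoning
  open StrictlyMonotone (relabel j) relabel-mono
  σ-letters : All (Letter j) σ
  σ-letters = All.map (λ {x} → letter-of x) isLetters
  distinct-relabel : distinct (map ∣_∣ σ) ≡ distinct (map (relabel j) σ)
  distinct-relabel = distinct-map-cong ∣_∣ (relabel j)
    (≡ᵇ-cong-injective ∣_∣ (relabel j) ∣∣-injective (λ lx ly → injective (letter lx) (letter ly))) σ-letters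
  origin-fresh : not (any (suc j ≡ᵇ_) (map (relabel j) σ)) ≡ true
  origin-fresh = Equivalence.to T-≡ (All⇒not-any (map⁺ (All.map
    (λ lx → ≢⇒T-not-≡ᵇ (origin≢letter lx ∘ injective origin (letter lx))) σ-letters)))
  des-relabel : des σ ≡ descentsℕ (suc j ∷ map (relabel j) σ)
  des-relabel = descents-map (relabel j) ⌊<?⌋≡<ᵇ origin (All.map letter σ-letters)

descentsℕ-≤ : (x : ℕ) (τ : List ℕ) → descentsℕ (x ∷ τ) ≤ length τ
descentsℕ-≤ x []      = z≤n
descentsℕ-≤ x (y ∷ τ) with y <ᵇ x
... | true  = s≤s (descentsℕ-≤ y τ)
... | false = m≤n⇒m≤1+n (descentsℕ-≤ y τ)

A≡count : (m k : ℕ) → A m k ≡ count (isPermWithDescents k) (allLists (oneTo m) m)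
A≡count m k = count-filterᵇ (λ τ → descentsℕ τ ≡ᵇ k) distinct (allLists (oneTo m) m)

b≡count-startingWith : ∀ {n j} k → j ≤ n →
  b n k j ≡ count (isPermWithDescents k ∘ (suc j ∷_)) (allLists (oneTo (suc n)) n)
b≡count-startingWith {n} {j} k j≤n = begin
  b n k j
    ≡⟨ count-filterᵇ _ (isSignedPerm n) (allLists (intRange n) n) ⟩
  count (isSignedPermWith n k j) (allLists (intRange n) n)
    ≡⟨ count-allLists-restrict (isLetter n j) _ (intRange n) n only-letters ⟩
  count (isSignedPermWith n k j) (allLists (letters n j) n)
    ≡⟨ count-allLists-cong n isSignedPermWith≡isPermWithDescents (all-filter (T? ∘ isLetter n j) (intRange n)) ⟩
  count (P ∘ map (relabel j)) (allLists (letters n j) n)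
    ≡⟨ count-allLists-map P (relabel j) (letters n j) n ⟨
  count P (allLists (map (relabel j) (letters n j)) n)
    ≡⟨ count-allLists-↭ P (relabel-letters↭ j≤n) n ⟩
  count P (allLists (remove (suc j) (oneTo (suc n))) n)
    ≡⟨ count-allLists-restrict (not ∘ (suc j ≡ᵇ_)) P (oneTo (suc n)) n avoids-first ⟨
  count P (allLists (oneTo (suc n)) n) ∎
  where
  open ≡-Reasoning
  P : List ℕ → Bool
  P = isPermWithDescents k ∘ (suc j ∷_)
  only-letters : ∀ {σ} → T (isSignedPermWith n k j σ) → All (T ∘ isLetter n j) σ
  only-letters {σ} h = All-isLetter⇐
    (T-∧ˡ (all (inRange n) σ) (T-∧ˡ (isSignedPerm n σ) h))
    (T-∧ʳ (des σ ≡ᵇ k) (T-∧ʳ (isSignedPerm n σ) h))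
  avoids-first : ∀ {τ} → T (P τ) → All (T ∘ not ∘ (suc j ≡ᵇ_)) τ
  avoids-first {τ} h = not-any⇒All τ (proj₁ (T-distinct-∷ (suc j) τ (T-∧ˡ (distinct (suc j ∷ τ)) h)))

∑ⱼ-b≡A : (n k : ℕ) → sumTo n (λ j → b n k j) ≡ A (suc n) k
∑ⱼ-b≡A n k = begin
  sumTo n (λ j → b n k j)
    ≡⟨ sumTo-cong n (b≡count-startingWith k) ⟩
  sumTo n (λ j → count (P ∘ (suc j ∷_)) words)
    ≡⟨ sumTo-upTo n (λ j → count (P ∘ (suc j ∷_)) words) ⟩
  sum (map (λ j → count (P ∘ (suc j ∷_)) words) (upTo (suc n)))
    ≡⟨ cong sum (map-∘ (upTo (suc n))) ⟩
  sum (map (λ x → count (P ∘ (x ∷_)) words) (oneTo (suc n)))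
    ≡⟨ count-allLists-suc P (oneTo (suc n)) n ⟨
  count P (allLists (oneTo (suc n)) (suc n))
    ≡⟨ A≡count (suc n) k ⟨
  A (suc n) k ∎
  where
  open ≡-Reasoning
  P : List ℕ → Bool
  P = isPermWithDescents k
  words : List (List ℕ)
  words = allLists (oneTo (suc n)) n

∑ₖ-b≡n! : {n j : ℕ} → j ≤ n → sumTo n (λ k → b n k j) ≡ n !
∑ₖ-b≡n! {n} {j} j≤n = begin
  sumTo n (λ k → b n k j)
    ≡⟨ sumTo-cong n (λ {k} _ → b≡count-startingWith k j≤n) ⟩
  sumTo n (λ k → count (isPermWithDescents k ∘ (suc j ∷_)) words)
    ≡⟨ sumTo-count-fibres (distinct ∘ (suc j ∷_)) (descentsℕ ∘ (suc j ∷_)) n bounded ⟩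
  count (distinct ∘ (suc j ∷_)) words
    ≡⟨ count-distinct-∷ (suc j) (oneTo (suc n)) n ⟩
  count distinct (allLists rest n)
    ≡⟨ count-arrangements n rest length-rest distinct-rest ⟩
  n ! ∎
  where
  open ≡-Reasoning
  words : List (List ℕ)
  words = allLists (oneTo (suc n)) n
  rest : List ℕ
  rest = remove (suc j) (oneTo (suc n))
  bounded : All (λ τ → descentsℕ (suc j ∷ τ) ≤ n) words
  bounded = All-allLists {P = λ _ → ⊤} n
    (λ {τ} l _ → subst (descentsℕ (suc j ∷ τ) ≤_) l (descentsℕ-≤ (suc j) τ))
    (All.universal (λ _ → tt) (oneTo (suc n)))
  distinct-oneTo : T (distinct (oneTo (suc n)))
  distinct-oneTo = Unique⇒distinct (Unique.map⁺ suc-injective (Unique.upTo⁺ (suc n)))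
  distinct-rest : T (distinct rest)
  distinct-rest = distinct-filterᵇ (not ∘ (suc j ≡ᵇ_)) (oneTo (suc n)) distinct-oneTo
  length-rest : length rest ≡ n
  length-rest = suc-injective (begin
    suc (length rest)
      ≡⟨ length-remove (suc j) (oneTo (suc n)) distinct-oneTo (∈⇒any-≡ᵇ (∈-map⁺ suc (∈-upTo⁺ (s≤s j≤n)))) ⟩
    length (oneTo (suc n))
      ≡⟨ length-map suc (upTo (suc n)) ⟩
    length (upTo (suc n))
      ≡⟨ length-applyUpTo id (suc n) ⟩
    suc n ∎)

proposition5p3 : (n k j : ℕ) → k ≤ n → j ≤ n →
    (sumTo n (λ j′ → b n k j′) ≡ A (suc n) k) × (sumTo n (λ k′ → b n k′ j) ≡ n !)
proposition5p3 n k j _ j≤n = ∑ⱼ-b≡A n k , ∑ₖ-b≡n! j≤n
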